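{- Let $n\ge 2$ and let $\sigma\in\mathfrak{S}_{n-1}$ be such that $\phi^{ -1}(\sigma)$ is non-decreasing. Regard $\sigma$ as a permutation of $[n]$ fixing $n$, let $j$ be an integer with $\sigma(n-1)\le j\le n$, and let $\sigma'=\sigma\cdot(n,j)$. Then $\phi^{ -1}(\sigma')$ is non-decreasing.
   Context: $[n]=\{1,\dots,n\}$, $\mathfrak{S}_n$ the symmetric group on $[n]$; products of permutations are composed with the leftmost factor acting first: $(\alpha\beta)(x)=\beta(\alpha(x))$, and $(n,n)$ denotes the identity. A function $f:[n]\to[n]$ is subexceedant if $1\le f(i)\le i$ for all $i$, written as the word $f_1\cdots f_n$; $F_n$ is the set of such functions. $\phi:F_n\to\mathfrak{S}_n$, $\phi(f)=(1,f_1)(2,f_2)\cdots(n,f_n)$, is a bijection; $\phi^{ -1}(\sigma)$ is called the nom code of $\sigma$. A subexceedant function is non-decreasing if $f_1\le f_2\le\cdots\le f_n$. -}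

module Defs where

open import Data.Nat using (ℕ; suc; _<?_)
open import Data.Fin using (Fin; toℕ; fromℕ; fromℕ<; inject₁; _≟_; _≤_)
open import Data.List using (List; []; _∷_; map)
open import Data.Product using (_×_; _,_)
open import Relation.Nullary using (yes; no)
open import Relation.Binary.PropositionalEquality using (_≡_)

-- Elements of [n] are represented by Fin n, with value i+1 encoded as i
-- (so all order comparisons are shifted by one, uniformly).

transp : {n : ℕ} → Fin n → Fin n → Fin n → Fin n
transp a b x with x ≟ a
... | yes _ = b
... | no _ with x ≟ b
...   | yes _ = a
...   | no _ = x

applyTransps : {n : ℕ} → List (Fin n × Fin n) → Fin n → Fin n
applyTransps [] x = x
applyTransps ((a , b) ∷ ts) x = applyTransps ts (transp a b x)

allFin' : (n : ℕ) → List (Fin n)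
allFin' n = Data.List.Base.allFin n
  where import Data.List.Base

Subexceedant : {n : ℕ} → (Fin n → Fin n) → Set
Subexceedant {n} f = ∀ (i : Fin n) → f i ≤ i

-- φ(f) = (1,f_1)(2,f_2)⋯(n,f_n), leftmost factor acting first.
phi : {n : ℕ} → (Fin n → Fin n) → Fin n → Fin n
phi {n} f = applyTransps (map (λ i → (i , f i)) (allFin' n))

-- f is the nom code of σ, i.e. f = φ⁻¹(σ): f ∈ F_n and φ(f) = σ.
IsNomCode : {n : ℕ} → (Fin n → Fin n) → (Fin n → Fin n) → Set
IsNomCode {n} f σ = Subexceedant f × (∀ (x : Fin n) → phi f x ≡ σ x)

NonDecreasing : {n : ℕ} → (Fin n → Fin n) → Set
NonDecreasing {n} f = ∀ (i i' : Fin n) → i ≤ i' → f i ≤ f i'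

extend : {m : ℕ} → (Fin m → Fin m) → Fin (suc m) → Fin (suc m)
extend {m} σ x with toℕ x <? m
... | yes p = inject₁ (σ (fromℕ< p))
... | no _ = x

_·_ : {n : ℕ} → (Fin n → Fin n) → (Fin n → Fin n) → Fin n → Fin n
(σ · τ) x = τ (σ x)

{-# OPTIONS --safe #-}
-- Peeling off the last factor, φ(h) = φ(h|[n-1]) · (n, h_n) with φ(h)(n) = h_n; by induction
-- this makes φ injective on subexceedant functions.  Since σ' = σ · (n, j) and σ fixes n,
-- the nom code of σ' is therefore the nom code f of σ followed by the letter j.  It is
-- non-decreasing because f is, and because its last letter satisfies
-- f_{n-1} = φ(f)(n-1) = σ(n-1) ≤ j.
module Submission where

open import Defs
open import Data.Nat using (ℕ; zero; suc; _<?_)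
import Data.Nat as ℕ
import Data.Nat.Properties as ℕₚ
import Data.Fin as Fin
open import Data.Fin using (Fin; fromℕ; inject₁; lower₁; toℕ; _≤_; _≟_)
open import Data.Fin.Properties
  using (toℕ-injective; toℕ-inject₁; toℕ-fromℕ; toℕ-fromℕ<; toℕ-lower₁;
         inject₁ℕ<; inject₁-injective; inject₁-lower₁; fromℕ≢inject₁; ≤fromℕ;
         ≤-refl; ≤-trans; ≤-antisym)
open import Data.Fin.Relation.Unary.Top using (View; view; ‵fromℕ; ‵inject₁)
open import Data.List using (List; []; _∷_; map; _++_; _∷ʳ_; tabulate)
open import Data.List.Properties using (map-tabulate; tabulate-cong)
open import Data.Product using (_×_; _,_; proj₁; proj₂)
open import Relation.Nullary using (yes; no; ¬_; contradiction)
open import Relation.Binary.PropositionalEquality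
open import Function using (_∘_)

private
  variable
    m : ℕ

transp-left : (a b : Fin m) → transp a b a ≡ b
transp-left a b with a ≟ a
... | yes _ = refl
... | no a≢a = contradiction refl a≢a

transp-right : (a b : Fin m) → transp a b b ≡ a
transp-right a b with b ≟ a
... | yes b≡a = b≡a
... | no _ with b ≟ b
...   | yes _ = refl
...   | no b≢b = contradiction refl b≢b

transp-other : (a b x : Fin m) → ¬ x ≡ a → ¬ x ≡ b → transp a b x ≡ x
transp-other a b x x≢a x≢b with x ≟ a
... | yes x≡a = contradiction x≡a x≢a
... | no _ with x ≟ b
...   | yes x≡b = contradiction x≡b x≢b
...   | no _ = refl

transp-involutive : (a b x : Fin m) → transp a b (transp a b x) ≡ x
transp-involutive a b x with x ≟ a
... | yes refl = transp-right x b
... | no x≢a with x ≟ b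
...   | yes refl = transp-left a x
...   | no x≢b = transp-other a b x x≢a x≢b

transp-injective : (a b : Fin m) {x y : Fin m} → transp a b x ≡ transp a b y → x ≡ y
transp-injective a b {x} {y} eq = begin
  x                         ≡⟨ sym (transp-involutive a b x) ⟩
  transp a b (transp a b x) ≡⟨ cong (transp a b) eq ⟩
  transp a b (transp a b y) ≡⟨ transp-involutive a b y ⟩
  y                         ∎
  where open ≡-Reasoning

transp-inject₁ : (a b x : Fin m) →
  transp (inject₁ a) (inject₁ b) (inject₁ x) ≡ inject₁ (transp a b x)
transp-inject₁ a b x with x ≟ a
... | yes refl = transp-left (inject₁ x) (inject₁ b)
... | no x≢a with x ≟ b
...   | yes refl = transp-right (inject₁ a) (inject₁ x)
...   | no x≢b = transp-other _ _ _ (x≢a ∘ inject₁-injective) (x≢b ∘ inject₁-injective)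

inject₁-pair : Fin m × Fin m → Fin (suc m) × Fin (suc m)
inject₁-pair (a , b) = inject₁ a , inject₁ b

applyTransps-++ : (ts us : List (Fin m × Fin m)) (x : Fin m) →
  applyTransps (ts ++ us) x ≡ applyTransps us (applyTransps ts x)
applyTransps-++ []             us x = refl
applyTransps-++ ((a , b) ∷ ts) us x = applyTransps-++ ts us (transp a b x)

applyTransps-inject₁ : (ts : List (Fin m × Fin m)) (x : Fin m) →
  applyTransps (map inject₁-pair ts) (inject₁ x) ≡ inject₁ (applyTransps ts x)
applyTransps-inject₁ []             x = refl
applyTransps-inject₁ ((a , b) ∷ ts) x =
  trans (cong (applyTransps (map inject₁-pair ts)) (transp-inject₁ a b x))
        (applyTransps-inject₁ ts (transp a b x))

applyTransps-fromℕ : (ts : List (Fin m × Fin m)) →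
  applyTransps (map inject₁-pair ts) (fromℕ m) ≡ fromℕ m
applyTransps-fromℕ []             = refl
applyTransps-fromℕ ((a , b) ∷ ts) =
  trans (cong (applyTransps (map inject₁-pair ts))
              (transp-other _ _ _ fromℕ≢inject₁ fromℕ≢inject₁))
        (applyTransps-fromℕ ts)

tabulate-inject₁-∷ʳ : {A : Set} (f : Fin (suc m) → A) →
  tabulate f ≡ tabulate (f ∘ inject₁) ∷ʳ f (fromℕ m)
tabulate-inject₁-∷ʳ {m = zero}  f = refl
tabulate-inject₁-∷ʳ {m = suc m} f = cong (f Fin.zero ∷_) (tabulate-inject₁-∷ʳ (f ∘ Fin.suc))

restrict-avoids-top : (h : Fin (suc m) → Fin (suc m)) → Subexceedant h →
  (i : Fin m) → m ≢ toℕ (h (inject₁ i))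
restrict-avoids-top h sh i = ≢-sym (ℕₚ.<⇒≢ (ℕₚ.≤-<-trans (sh (inject₁ i)) (inject₁ℕ< i)))

restrict : (h : Fin (suc m) → Fin (suc m)) → Subexceedant h → Fin m → Fin m
restrict h sh i = lower₁ (h (inject₁ i)) (restrict-avoids-top h sh i)

inject₁-restrict : (h : Fin (suc m) → Fin (suc m)) (sh : Subexceedant h) (i : Fin m) →
  inject₁ (restrict h sh i) ≡ h (inject₁ i)
inject₁-restrict h sh i = inject₁-lower₁ _ (restrict-avoids-top h sh i)

restrict-subexceedant : (h : Fin (suc m) → Fin (suc m)) (sh : Subexceedant h) →
  Subexceedant (restrict h sh)
restrict-subexceedant h sh i =
  subst₂ ℕ._≤_ (sym (toℕ-lower₁ _ (restrict-avoids-top h sh i))) (toℕ-inject₁ i) (sh (inject₁ i))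

nomTransps : (Fin m → Fin m) → List (Fin m × Fin m)
nomTransps h = tabulate (λ i → (i , h i))

phi-nomTransps : (h : Fin m → Fin m) (x : Fin m) → phi h x ≡ applyTransps (nomTransps h) x
phi-nomTransps h x = cong (λ ts → applyTransps ts x) (map-tabulate (λ i → i) (λ i → (i , h i)))

nomTransps-restrict : (h : Fin (suc m) → Fin (suc m)) (sh : Subexceedant h) →
  nomTransps h ≡ map inject₁-pair (nomTransps (restrict h sh)) ∷ʳ (fromℕ m , h (fromℕ m))
nomTransps-restrict h sh = begin
  nomTransps h
    ≡⟨ tabulate-inject₁-∷ʳ (λ i → (i , h i)) ⟩
  tabulate (λ i → (inject₁ i , h (inject₁ i))) ∷ʳ _
    ≡⟨ cong (_∷ʳ _) (tabulate-cong (λ i → cong (inject₁ i ,_) (sym (inject₁-restrict h sh i)))) ⟩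
  tabulate (inject₁-pair ∘ λ i → (i , restrict h sh i)) ∷ʳ _
    ≡⟨ cong (_∷ʳ _) (sym (map-tabulate _ inject₁-pair)) ⟩
  map inject₁-pair (nomTransps (restrict h sh)) ∷ʳ _
    ∎
  where open ≡-Reasoning

phi-restrict : (h : Fin (suc m) → Fin (suc m)) (sh : Subexceedant h) (x : Fin (suc m)) →
  phi h x ≡ transp (fromℕ m) (h (fromℕ m))
                   (applyTransps (map inject₁-pair (nomTransps (restrict h sh))) x)
phi-restrict {m} h sh x = begin
  phi h x                                ≡⟨ phi-nomTransps h x ⟩
  applyTransps (nomTransps h) x          ≡⟨ cong (λ ts → applyTransps ts x) (nomTransps-restrict h sh) ⟩
  applyTransps (ts ++ (_ ∷ [])) x        ≡⟨ applyTransps-++ ts _ x ⟩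
  transp _ _ (applyTransps ts x)         ∎
  where
  open ≡-Reasoning
  ts : List (Fin (suc m) × Fin (suc m))
  ts = map inject₁-pair (nomTransps (restrict h sh))

phi-fromℕ : (h : Fin (suc m) → Fin (suc m)) → Subexceedant h → phi h (fromℕ m) ≡ h (fromℕ m)
phi-fromℕ {m} h sh = begin
  phi h (fromℕ m)
    ≡⟨ phi-restrict h sh (fromℕ m) ⟩
  transp (fromℕ m) (h (fromℕ m)) (applyTransps (map inject₁-pair (nomTransps (restrict h sh))) (fromℕ m))
    ≡⟨ cong (transp _ _) (applyTransps-fromℕ (nomTransps (restrict h sh))) ⟩
  transp (fromℕ m) (h (fromℕ m)) (fromℕ m)
    ≡⟨ transp-left (fromℕ m) (h (fromℕ m)) ⟩
  h (fromℕ m)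
    ∎
  where open ≡-Reasoning

phi-inject₁ : (h : Fin (suc m) → Fin (suc m)) (sh : Subexceedant h) (y : Fin m) →
  phi h (inject₁ y) ≡ transp (fromℕ m) (h (fromℕ m)) (inject₁ (phi (restrict h sh) y))
phi-inject₁ h sh y = begin
  phi h (inject₁ y)
    ≡⟨ phi-restrict h sh (inject₁ y) ⟩
  transp _ _ (applyTransps (map inject₁-pair (nomTransps (restrict h sh))) (inject₁ y))
    ≡⟨ cong (transp _ _) (applyTransps-inject₁ (nomTransps (restrict h sh)) y) ⟩
  transp _ _ (inject₁ (applyTransps (nomTransps (restrict h sh)) y))
    ≡⟨ cong (transp _ _ ∘ inject₁) (sym (phi-nomTransps (restrict h sh) y)) ⟩
  transp _ _ (inject₁ (phi (restrict h sh) y))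
    ∎
  where open ≡-Reasoning

phi-injective : (h h′ : Fin m → Fin m) → Subexceedant h → Subexceedant h′ →
  (∀ x → phi h x ≡ phi h′ x) → ∀ i → h i ≡ h′ i
phi-injective {zero}  h h′ sh sh′ φh≗φh′ ()
phi-injective {suc m} h h′ sh sh′ φh≗φh′ i = agree (view i)
  where
  open ≡-Reasoning
  L : Fin (suc m)
  L = fromℕ m

  top : h L ≡ h′ L
  top = trans (sym (phi-fromℕ h sh)) (trans (φh≗φh′ L) (phi-fromℕ h′ sh′))

  restrictions : ∀ x → phi (restrict h sh) x ≡ phi (restrict h′ sh′) x
  restrictions x = inject₁-injective (transp-injective L (h L) (begin
    transp L (h L) (inject₁ (phi (restrict h sh) x))    ≡⟨ sym (phi-inject₁ h sh x) ⟩
    phi h (inject₁ x)                                   ≡⟨ φh≗φh′ (inject₁ x) ⟩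
    phi h′ (inject₁ x)                                  ≡⟨ phi-inject₁ h′ sh′ x ⟩
    transp L (h′ L) (inject₁ (phi (restrict h′ sh′) x)) ≡⟨ cong (λ c → transp L c (inject₁ (phi (restrict h′ sh′) x))) (sym top) ⟩
    transp L (h L) (inject₁ (phi (restrict h′ sh′) x))  ∎))

  agree : ∀ {i} → View i → h i ≡ h′ i
  agree ‵fromℕ       = top
  agree (‵inject₁ y) = begin
    h (inject₁ y)               ≡⟨ sym (inject₁-restrict h sh y) ⟩
    inject₁ (restrict h sh y)   ≡⟨ cong inject₁ (phi-injective _ _ (restrict-subexceedant h sh)
                                     (restrict-subexceedant h′ sh′) restrictions y) ⟩
    inject₁ (restrict h′ sh′ y) ≡⟨ inject₁-restrict h′ sh′ y ⟩
    h′ (inject₁ y)              ∎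

extend-fromℕ : (σ : Fin m → Fin m) → extend σ (fromℕ m) ≡ fromℕ m
extend-fromℕ {m} σ with toℕ (fromℕ m) <? m
... | yes m<m = contradiction m<m (ℕₚ.<-irrefl (toℕ-fromℕ m))
... | no _    = refl

extend-inject₁ : (σ : Fin m → Fin m) (y : Fin m) → extend σ (inject₁ y) ≡ inject₁ (σ y)
extend-inject₁ {m} σ y with toℕ (inject₁ y) <? m
... | yes y<m = cong (inject₁ ∘ σ) (toℕ-injective (trans (toℕ-fromℕ< y<m) (toℕ-inject₁ y)))
... | no y≮m  = contradiction (inject₁ℕ< y) y≮m

nomCode-extend-·-transp : (σ f : Fin m → Fin m) → IsNomCode f σ →
  (j : Fin (suc m)) (g : Fin (suc m) → Fin (suc m)) →
  IsNomCode g (extend σ · transp (fromℕ m) j) →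
  g (fromℕ m) ≡ j × (∀ y → g (inject₁ y) ≡ inject₁ (f y))
nomCode-extend-·-transp {m} σ f (sf , φf≗σ) j g (sg , φg≗σ′) = top , g∘inject₁
  where
  open ≡-Reasoning
  L : Fin (suc m)
  L = fromℕ m

  top : g L ≡ j
  top = begin
    g L                      ≡⟨ sym (phi-fromℕ g sg) ⟩
    phi g L                  ≡⟨ φg≗σ′ L ⟩
    transp L j (extend σ L)  ≡⟨ cong (transp L j) (extend-fromℕ σ) ⟩
    transp L j L             ≡⟨ transp-left L j ⟩
    j                        ∎

  restriction : ∀ y → phi (restrict g sg) y ≡ phi f y
  restriction y = inject₁-injective (transp-injective L j (begin
    transp L j (inject₁ (phi (restrict g sg) y))   ≡⟨ cong (λ c → transp L c (inject₁ (phi (restrict g sg) y))) (sym top) ⟩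
    transp L (g L) (inject₁ (phi (restrict g sg) y)) ≡⟨ sym (phi-inject₁ g sg y) ⟩
    phi g (inject₁ y)                              ≡⟨ φg≗σ′ (inject₁ y) ⟩
    transp L j (extend σ (inject₁ y))              ≡⟨ cong (transp L j) (extend-inject₁ σ y) ⟩
    transp L j (inject₁ (σ y))                     ≡⟨ cong (transp L j ∘ inject₁) (sym (φf≗σ y)) ⟩
    transp L j (inject₁ (phi f y))                 ∎))

  g∘inject₁ : ∀ y → g (inject₁ y) ≡ inject₁ (f y)
  g∘inject₁ y = begin
    g (inject₁ y)             ≡⟨ sym (inject₁-restrict g sg y) ⟩
    inject₁ (restrict g sg y) ≡⟨ cong inject₁ (phi-injective _ f (restrict-subexceedant g sg) sf restriction y) ⟩
    inject₁ (f y)             ∎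

inject₁-mono-≤ : {i j : Fin m} → i ≤ j → inject₁ i ≤ inject₁ j
inject₁-mono-≤ {i = i} {j} = subst₂ ℕ._≤_ (sym (toℕ-inject₁ i)) (sym (toℕ-inject₁ j))

inject₁-cancel-≤ : {i j : Fin m} → inject₁ i ≤ inject₁ j → i ≤ j
inject₁-cancel-≤ {i = i} {j} = subst₂ ℕ._≤_ (toℕ-inject₁ i) (toℕ-inject₁ j)

nonDecreasing-fromℕ-inject₁ : (g : Fin (suc m) → Fin (suc m)) →
  (∀ a b → a ≤ b → g (inject₁ a) ≤ g (inject₁ b)) →
  (∀ a → g (inject₁ a) ≤ g (fromℕ m)) →
  NonDecreasing g
nonDecreasing-fromℕ-inject₁ {m} g mono bounded i i′ = compare (view i) (view i′)
  where
  compare : ∀ {i i′} → View i → View i′ → i ≤ i′ → g i ≤ g i′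
  compare ‵fromℕ       ‵fromℕ       _   = ≤-refl
  compare ‵fromℕ       (‵inject₁ b) L≤b = contradiction (≤-antisym L≤b (≤fromℕ (inject₁ b))) fromℕ≢inject₁
  compare (‵inject₁ a) ‵fromℕ       _   = bounded a
  compare (‵inject₁ a) (‵inject₁ b) a≤b = mono a b (inject₁-cancel-≤ a≤b)

proposition4p2 : (k : ℕ) (σ f : Fin (suc k) → Fin (suc k)) →
    IsNomCode f σ → NonDecreasing f →
    (j : Fin (suc (suc k))) → inject₁ (σ (fromℕ k)) ≤ j →
    (g : Fin (suc (suc k)) → Fin (suc (suc k))) →
    IsNomCode g (extend σ · transp (fromℕ (suc k)) j) →
    NonDecreasing g
proposition4p2 k σ f nomf@(sf , φf≗σ) ndf j σk≤j g nomg =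
  nonDecreasing-fromℕ-inject₁ g mono bounded
  where
  top : g (fromℕ (suc k)) ≡ j
  top = proj₁ (nomCode-extend-·-transp σ f nomf j g nomg)

  g∘inject₁ : ∀ y → g (inject₁ y) ≡ inject₁ (f y)
  g∘inject₁ = proj₂ (nomCode-extend-·-transp σ f nomf j g nomg)

  last-letter : f (fromℕ k) ≡ σ (fromℕ k)
  last-letter = trans (sym (phi-fromℕ f sf)) (φf≗σ (fromℕ k))

  mono : ∀ a b → a ≤ b → g (inject₁ a) ≤ g (inject₁ b)
  mono a b a≤b = subst₂ _≤_ (sym (g∘inject₁ a)) (sym (g∘inject₁ b)) (inject₁-mono-≤ (ndf a b a≤b))

  bounded : ∀ a → g (inject₁ a) ≤ g (fromℕ (suc k))
  bounded a = subst₂ _≤_ (sym (g∘inject₁ a)) (sym top)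
    (≤-trans (inject₁-mono-≤ (ndf a (fromℕ k) (≤fromℕ a)))
             (subst (λ c → inject₁ c ≤ j) (sym last-letter) σk≤j))
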